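{- Let $k\geq 1$ and write $k=k'2^\ell$ with $k'$ odd and $\ell\ge 0$. Then $\alpha(k) = \frac{m(k)}{2} - \frac{2\cdot 4^{\ell-1}+1}{3}$.
   Context: Let $(a(n))_{n\ge 0}$ be the Rudin-Shapiro sequence, defined by $a(0)=1$, $a(2n)=a(n)$, $a(2n+1)=(-1)^n a(n)$ for $n\ge 0$. Let $s(n)=\sum_{0\le i\le n} a(i)$. For $k\ge 1$, $\alpha(k)$ is the smallest $n\ge 0$ with $s(n)=k$. For $k\ge 0$, $m(k)$ denotes the integer obtained by reading the base-$2$ representation of $k$ as a base-$4$ numeral; i.e., if $k=\sum_i c_i 2^i$ with $c_i\in\{0,1\}$, then $m(k)=\sum_i c_i 4^i$. -}

module Defs where

open import Data.Nat using (ℕ; zero; suc; _+_; _*_; _^_; _/_; _%_; _≡ᵇ_)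
open import Data.Integer using (ℤ; +_; -_)
import Data.Integer as ℤ
open import Data.Bool using (if_then_else_)

sign : ℕ → ℤ
sign zero = + 1
sign (suc n) = - sign n

-- Rudin-Shapiro sequence, by the recursion a(0)=1, a(2n)=a(n), a(2n+1)=(-1)^n a(n).
-- Computed with fuel; fuel n suffices for argument n since n/2 < n for n ≥ 1.
rsFuel : ℕ → ℕ → ℤ
rsFuel zero    n = + 1
rsFuel (suc f) n =
  if n ≡ᵇ 0 then + 1
  else (if n % 2 ≡ᵇ 0 then rsFuel f (n / 2)
        else sign (n / 2) ℤ.* rsFuel f (n / 2))

a : ℕ → ℤ
a n = rsFuel n n

s : ℕ → ℤ
s zero = a 0
s (suc n) = s n ℤ.+ a (suc n)

-- m(k): binary digits of k read in base 4 (fuel k suffices)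
mFuel : ℕ → ℕ → ℕ
mFuel zero    k = 0
mFuel (suc f) k = k % 2 + 4 * mFuel f (k / 2)

m : ℕ → ℕ
m k = mFuel k k

module Submission where

-- Write α(K) for the first index n with s(n) = K. Since s(0) = 1 and s moves by ±1, n = α(K)
-- exactly when s(n) = K and s(j) < K for all j < n; in particular a(α(K)) = 1. Grouping indices in
-- blocks of four gives s(4q) = 2s(q) − a(q), s(4q+1) = s(4q+3) = 2s(q) and
-- s(4q+2) = 2s(q) + (−1)^q a(q), so every s(t) with t < 4α(K) is at most 2K − 1. Reading off the
-- first values of s after index 4α(K) gives α(2K) = 4α(K) + 1, α(2K + 1) = 4α(K) + 2 when α(K) is
-- even, and α(2K − 1) = 4α(K) when K is odd; in the last case the value 2K − 1 is not hit earlier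
-- because s is odd at even indices. Binary induction then yields α(2j + 1) = 2m(j), and doubling
-- ℓ times turns this into 6α(k′2^ℓ) + 4^ℓ + 2 = 3m(k′2^ℓ).

open import Defs

module RudinShapiro where

  open import Algebra.Bundles using (AbelianGroup)
  open import Data.Bool using (true; false; if_then_else_)
  open import Data.Integer as ℤ using (ℤ; +_; -[1+_]; 1ℤ; -1ℤ; ∣_∣; -≤+; +<+)
  import Data.Integer.Properties as ℤₚ
  open import Data.Integer.Tactic.RingSolver using (solve-∀)
  open import Data.Nat using (ℕ; zero; suc; _+_; _*_; _^_; _/_; _%_; _≤_; _<_; z≤n; s≤s; _≡ᵇ_)
  import Data.Nat.DivMod as ℕ
  open import Data.Nat.Induction using (<-rec)
  open import Data.Nat.Properties
    using (≤-refl; ≤-trans; ≤-<-trans; <-trans; ≤-pred; n<1+n; m≤n+m; m≤m+n; m<m+n;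
           m≤n⇒m<n∨m≡n; +-assoc; *-comm; *-assoc; *-suc; *-identityʳ; *-cancelˡ-<; even≢odd)
  import Data.Nat.Tactic.RingSolver as ℕ-Solver
  open import Data.Product using (∃; _×_; _,_)
  open import Data.Sum using (_⊎_; inj₁; inj₂)
  open import Relation.Binary.PropositionalEquality
    using (_≡_; _≢_; refl; sym; trans; cong; cong₂; subst; subst₂; module ≡-Reasoning)
  open import Relation.Nullary using (contradiction)

  open import Algebra.Properties.Group (AbelianGroup.group ℤₚ.+-0-abelianGroup) using (∙-cancelˡ)

  module FuelIndependence {A : Set} (F : ℕ → ℕ → A) (step : ℕ → A → A)
    (F-zero : ∀ f → F f 0 ≡ F 0 0)
    (F-suc : ∀ f n → F (suc f) (suc n) ≡ step (suc n) (F f (suc n / 2))) where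

    private
      half≤ : ∀ {n f} → n ≤ f → suc n / 2 ≤ f
      half≤ {n} n≤f = ≤-trans (≤-pred (ℕ.m/n<m (suc n) 2 (s≤s (s≤s z≤n)))) n≤f

    fuel-irrelevant : ∀ {f g n} → n ≤ f → n ≤ g → F f n ≡ F g n
    fuel-irrelevant {f} {g} {zero} _ _ = trans (F-zero f) (sym (F-zero g))
    fuel-irrelevant {suc f} {suc g} {suc n} (s≤s n≤f) (s≤s n≤g) =
      trans (F-suc f n)
        (trans (cong (step (suc n)) (fuel-irrelevant (half≤ n≤f) (half≤ n≤g)))
          (sym (F-suc g n)))

    diagonal-unfold : ∀ t → 0 < t → F t t ≡ step t (F (t / 2) (t / 2))
    diagonal-unfold (suc n) _ =
      trans (F-suc n n) (cong (step (suc n)) (fuel-irrelevant (half≤ ≤-refl) ≤-refl))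

  [2*n]%2≡0 : ∀ n → 2 * n % 2 ≡ 0
  [2*n]%2≡0 n = trans (cong (_% 2) (*-comm 2 n)) (ℕ.m*n%n≡0 n 2)

  [2*n]/2≡n : ∀ n → 2 * n / 2 ≡ n
  [2*n]/2≡n n = trans (cong (_/ 2) (*-comm 2 n)) (ℕ.m*n/n≡m n 2)

  [1+2*n]%2≡1 : ∀ n → (1 + 2 * n) % 2 ≡ 1
  [1+2*n]%2≡1 n = trans (cong (λ k → (1 + k) % 2) (*-comm 2 n)) (ℕ.[m+kn]%n≡m%n 1 n 2)

  [1+2*n]/2≡n : ∀ n → (1 + 2 * n) / 2 ≡ n
  [1+2*n]/2≡n n =
    trans (ℕ.+-distrib-/ 1 (2 * n) (subst (λ r → 1 + r < 2) (sym ([2*n]%2≡0 n)) ≤-refl))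
      ([2*n]/2≡n n)

  rsStep : ℕ → ℤ → ℤ
  rsStep n x = if n % 2 ≡ᵇ 0 then x else sign (n / 2) ℤ.* x

  mStep : ℕ → ℕ → ℕ
  mStep k x = k % 2 + 4 * x

  rsFuel-zero : ∀ f → rsFuel f 0 ≡ rsFuel 0 0
  rsFuel-zero zero = refl
  rsFuel-zero (suc f) = refl

  mFuel-zero : ∀ f → mFuel f 0 ≡ mFuel 0 0
  mFuel-zero zero = refl
  mFuel-zero (suc f) = cong (4 *_) (mFuel-zero f)

  module RS = FuelIndependence rsFuel rsStep rsFuel-zero (λ _ _ → refl)
  module M = FuelIndependence mFuel mStep mFuel-zero (λ _ _ → refl)

  rsStep-even : ∀ n {x y} → n % 2 ≡ 0 → x ≡ y → rsStep n x ≡ y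
  rsStep-even n n%2≡0 x≡y rewrite n%2≡0 = x≡y

  rsStep-odd : ∀ n {x y} → n % 2 ≡ 1 → x ≡ y → rsStep n x ≡ sign (n / 2) ℤ.* y
  rsStep-odd n n%2≡1 x≡y rewrite n%2≡1 = cong (sign (n / 2) ℤ.*_) x≡y

  a[2*n]≡a[n] : ∀ n → a (2 * n) ≡ a n
  a[2*n]≡a[n] zero = refl
  a[2*n]≡a[n] (suc n) = trans (RS.diagonal-unfold (2 * suc n) (s≤s z≤n))
    (rsStep-even (2 * suc n) ([2*n]%2≡0 (suc n)) (cong a ([2*n]/2≡n (suc n))))

  a[1+2*n]≡sign[n]*a[n] : ∀ n → a (1 + 2 * n) ≡ sign n ℤ.* a n
  a[1+2*n]≡sign[n]*a[n] n = trans (RS.diagonal-unfold (1 + 2 * n) (s≤s z≤n))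
    (trans (rsStep-odd (1 + 2 * n) ([1+2*n]%2≡1 n) (cong a ([1+2*n]/2≡n n)))
      (cong (λ k → sign k ℤ.* a n) ([1+2*n]/2≡n n)))

  m[2*n]≡4*m[n] : ∀ n → m (2 * n) ≡ 4 * m n
  m[2*n]≡4*m[n] zero = refl
  m[2*n]≡4*m[n] (suc n) = trans (M.diagonal-unfold (2 * suc n) (s≤s z≤n))
    (cong₂ (λ r x → r + 4 * x) ([2*n]%2≡0 (suc n)) (cong m ([2*n]/2≡n (suc n))))

  m[1+2*n]≡1+4*m[n] : ∀ n → m (1 + 2 * n) ≡ 1 + 4 * m n
  m[1+2*n]≡1+4*m[n] n = trans (M.diagonal-unfold (1 + 2 * n) (s≤s z≤n))
    (cong₂ (λ r x → r + 4 * x) ([1+2*n]%2≡1 n) (cong m ([1+2*n]/2≡n n)))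

  sign[2*n]≡1 : ∀ n → sign (2 * n) ≡ 1ℤ
  sign[2*n]≡1 zero = refl
  sign[2*n]≡1 (suc n) = trans (cong sign (*-suc 2 n)) (cong (λ x → ℤ.- (ℤ.- x)) (sign[2*n]≡1 n))

  sign[1+2*n]≡-1 : ∀ n → sign (1 + 2 * n) ≡ -1ℤ
  sign[1+2*n]≡-1 n rewrite sign[2*n]≡1 n = refl

  ∣sign∣≡1 : ∀ n → ∣ sign n ∣ ≡ 1
  ∣sign∣≡1 zero = refl
  ∣sign∣≡1 (suc n) = trans (ℤₚ.∣-i∣≡∣i∣ (sign n)) (∣sign∣≡1 n)

  ∣rsFuel∣≡1 : ∀ f n → ∣ rsFuel f n ∣ ≡ 1
  ∣rsFuel∣≡1 zero n = refl
  ∣rsFuel∣≡1 (suc f) n with n ≡ᵇ 0 | n % 2 ≡ᵇ 0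
  ... | true  | _     = refl
  ... | false | true  = ∣rsFuel∣≡1 f (n / 2)
  ... | false | false = trans (ℤₚ.abs-* (sign (n / 2)) (rsFuel f (n / 2)))
                          (cong₂ _*_ (∣sign∣≡1 (n / 2)) (∣rsFuel∣≡1 f (n / 2)))

  ∣a∣≡1 : ∀ n → ∣ a n ∣ ≡ 1
  ∣a∣≡1 n = ∣rsFuel∣≡1 n n

  ∣-a∣≡1 : ∀ n → ∣ ℤ.- a n ∣ ≡ 1
  ∣-a∣≡1 n = trans (ℤₚ.∣-i∣≡∣i∣ (a n)) (∣a∣≡1 n)

  ∣sign*a∣≡1 : ∀ n → ∣ sign n ℤ.* a n ∣ ≡ 1
  ∣sign*a∣≡1 n = trans (ℤₚ.abs-* (sign n) (a n)) (cong₂ _*_ (∣sign∣≡1 n) (∣a∣≡1 n))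

  2+4*q≡2*[1+2*q] : ∀ q → 2 + 4 * q ≡ 2 * (1 + 2 * q)
  2+4*q≡2*[1+2*q] = ℕ-Solver.solve-∀

  3+4*q≡1+2*[1+2*q] : ∀ q → 3 + 4 * q ≡ 1 + 2 * (1 + 2 * q)
  3+4*q≡1+2*[1+2*q] = ℕ-Solver.solve-∀

  a[4*q]≡a[q] : ∀ q → a (4 * q) ≡ a q
  a[4*q]≡a[q] q = begin
    a (4 * q)        ≡⟨ cong a (*-assoc 2 2 q) ⟩
    a (2 * (2 * q))  ≡⟨ a[2*n]≡a[n] (2 * q) ⟩
    a (2 * q)        ≡⟨ a[2*n]≡a[n] q ⟩
    a q              ∎
    where open ≡-Reasoning

  a[1+4*q]≡a[q] : ∀ q → a (1 + 4 * q) ≡ a q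
  a[1+4*q]≡a[q] q = begin
    a (1 + 4 * q)               ≡⟨ cong (λ k → a (1 + k)) (*-assoc 2 2 q) ⟩
    a (1 + 2 * (2 * q))         ≡⟨ a[1+2*n]≡sign[n]*a[n] (2 * q) ⟩
    sign (2 * q) ℤ.* a (2 * q)  ≡⟨ cong₂ ℤ._*_ (sign[2*n]≡1 q) (a[2*n]≡a[n] q) ⟩
    1ℤ ℤ.* a q                  ≡⟨ ℤₚ.*-identityˡ (a q) ⟩
    a q                         ∎
    where open ≡-Reasoning

  a[2+4*q]≡sign[q]*a[q] : ∀ q → a (2 + 4 * q) ≡ sign q ℤ.* a q
  a[2+4*q]≡sign[q]*a[q] q = begin
    a (2 + 4 * q)        ≡⟨ cong a (2+4*q≡2*[1+2*q] q) ⟩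
    a (2 * (1 + 2 * q))  ≡⟨ a[2*n]≡a[n] (1 + 2 * q) ⟩
    a (1 + 2 * q)        ≡⟨ a[1+2*n]≡sign[n]*a[n] q ⟩
    sign q ℤ.* a q       ∎
    where open ≡-Reasoning

  a[3+4*q]≡-sign[q]*a[q] : ∀ q → a (3 + 4 * q) ≡ ℤ.- (sign q ℤ.* a q)
  a[3+4*q]≡-sign[q]*a[q] q = begin
    a (3 + 4 * q)                       ≡⟨ cong a (3+4*q≡1+2*[1+2*q] q) ⟩
    a (1 + 2 * (1 + 2 * q))             ≡⟨ a[1+2*n]≡sign[n]*a[n] (1 + 2 * q) ⟩
    sign (1 + 2 * q) ℤ.* a (1 + 2 * q)  ≡⟨ cong₂ ℤ._*_ (sign[1+2*n]≡-1 q)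
                                                         (a[1+2*n]≡sign[n]*a[n] q) ⟩
    -1ℤ ℤ.* (sign q ℤ.* a q)            ≡⟨ ℤₚ.-1*i≡-i (sign q ℤ.* a q) ⟩
    ℤ.- (sign q ℤ.* a q)                ∎
    where open ≡-Reasoning

  x+y-y≡x : ∀ x y → x ℤ.+ y ℤ.- y ≡ x
  x+y-y≡x = solve-∀

  s[4*q]≡2*s[q]-a[q]             : ∀ q → s (4 * q) ≡ + 2 ℤ.* s q ℤ.- a q
  s[1+4*q]≡2*s[q]                : ∀ q → s (1 + 4 * q) ≡ + 2 ℤ.* s q
  s[2+4*q]≡2*s[q]+sign[q]*a[q]   : ∀ q → s (2 + 4 * q) ≡ + 2 ℤ.* s q ℤ.+ sign q ℤ.* a q
  s[3+4*q]≡2*s[q]                : ∀ q → s (3 + 4 * q) ≡ + 2 ℤ.* s q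

  s[4*q]≡2*s[q]-a[q] zero = refl
  s[4*q]≡2*s[q]-a[q] (suc q) = begin
    s (4 * suc q)                    ≡⟨ cong s (*-suc 4 q) ⟩
    s (3 + 4 * q) ℤ.+ a (4 + 4 * q)  ≡⟨ cong₂ ℤ._+_ (s[3+4*q]≡2*s[q] q)
                                          (trans (cong a (sym (*-suc 4 q))) (a[4*q]≡a[q] (suc q))) ⟩
    + 2 ℤ.* s q ℤ.+ a (suc q)        ≡⟨ 2x+y≡2[x+y]-y (s q) (a (suc q)) ⟩
    + 2 ℤ.* s (suc q) ℤ.- a (suc q)  ∎
    where
    open ≡-Reasoning
    2x+y≡2[x+y]-y : ∀ x y → + 2 ℤ.* x ℤ.+ y ≡ + 2 ℤ.* (x ℤ.+ y) ℤ.- y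
    2x+y≡2[x+y]-y = solve-∀

  s[1+4*q]≡2*s[q] q =
    trans (cong₂ ℤ._+_ (s[4*q]≡2*s[q]-a[q] q) (a[1+4*q]≡a[q] q)) (x-y+y≡x (+ 2 ℤ.* s q) (a q))
    where
    x-y+y≡x : ∀ x y → x ℤ.- y ℤ.+ y ≡ x
    x-y+y≡x = solve-∀

  s[2+4*q]≡2*s[q]+sign[q]*a[q] q = cong₂ ℤ._+_ (s[1+4*q]≡2*s[q] q) (a[2+4*q]≡sign[q]*a[q] q)

  s[3+4*q]≡2*s[q] q =
    trans (cong₂ ℤ._+_ (s[2+4*q]≡2*s[q]+sign[q]*a[q] q) (a[3+4*q]≡-sign[q]*a[q] q))
      (x+y-y≡x (+ 2 ℤ.* s q) (sign q ℤ.* a q))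

  data Parity : ℕ → Set where
    even : ∀ p → Parity (2 * p)
    odd  : ∀ p → Parity (1 + 2 * p)

  parity : ∀ n → Parity n
  parity zero = even 0
  parity (suc n) with parity n
  ... | even p = odd p
  ... | odd p  = subst Parity (*-suc 2 p) (even (suc p))

  data Quarter (q : ℕ) : ℕ → Set where
    4q+0 : Quarter q (4 * q)
    4q+1 : Quarter q (1 + 4 * q)
    4q+2 : Quarter q (2 + 4 * q)
    4q+3 : Quarter q (3 + 4 * q)

  quarter : ∀ t → ∃ λ q → Quarter q t
  quarter zero = 0 , 4q+0
  quarter (suc t) with quarter t
  ... | q , 4q+0 = q , 4q+1
  ... | q , 4q+1 = q , 4q+2
  ... | q , 4q+2 = q , 4q+3
  ... | q , 4q+3 = suc q , subst (Quarter (suc q)) (*-suc 4 q) 4q+0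

  Quarter⇒4*q≤t : ∀ {q t} → Quarter q t → 4 * q ≤ t
  Quarter⇒4*q≤t 4q+0 = ≤-refl
  Quarter⇒4*q≤t 4q+1 = m≤n+m _ 1
  Quarter⇒4*q≤t 4q+2 = m≤n+m _ 2
  Quarter⇒4*q≤t 4q+3 = m≤n+m _ 3

  Quarter⇒q<n : ∀ {q t n} → Quarter q t → t < 4 * n → q < n
  Quarter⇒q<n v t<4n = *-cancelˡ-< 4 _ _ (≤-<-trans (Quarter⇒4*q≤t v) t<4n)

  binary-induction : (P : ℕ → Set) → P 0 → (∀ j → 0 < j → P j → P (2 * j)) →
                     (∀ j → P j → P (1 + 2 * j)) → ∀ j → P j
  binary-induction P P0 P-even P-odd = <-rec P step
    where
    step : ∀ j → (∀ {i} → i < j → P i) → P j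
    step j rec with parity j
    ... | even zero    = P0
    ... | even (suc i) = P-even (suc i) (s≤s z≤n) (rec (m<m+n (suc i) (s≤s z≤n)))
    ... | odd i        = P-odd i (rec (s≤s (m≤m+n i (i + 0))))

  ∣i∣≡1⇒i≡±1 : ∀ {i} → ∣ i ∣ ≡ 1 → i ≡ 1ℤ ⊎ i ≡ -1ℤ
  ∣i∣≡1⇒i≡±1 {+ _} refl = inj₁ refl
  ∣i∣≡1⇒i≡±1 { -[1+ _ ]} refl = inj₂ refl

  ∣i∣≡1⇒i≤1 : ∀ {i} → ∣ i ∣ ≡ 1 → i ℤ.≤ 1ℤ
  ∣i∣≡1⇒i≤1 {+ _} refl = ℤₚ.≤-refl
  ∣i∣≡1⇒i≤1 { -[1+ _ ]} refl = -≤+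

  2*x+u≢2*y : ∀ {u} x y → ∣ u ∣ ≡ 1 → + 2 ℤ.* x ℤ.+ u ≢ + 2 ℤ.* y
  2*x+u≢2*y {u} x y ∣u∣≡1 eq = even≢odd ∣ y ℤ.- x ∣ 0 (begin
    2 * ∣ y ℤ.- x ∣        ≡⟨ ℤₚ.abs-* (+ 2) (y ℤ.- x) ⟨
    ∣ + 2 ℤ.* (y ℤ.- x) ∣  ≡⟨ cong ∣_∣ u≡2[y-x] ⟨
    ∣ u ∣                  ≡⟨ ∣u∣≡1 ⟩
    1                      ∎)
    where
    open ≡-Reasoning
    u≡2x+u-2x : ∀ x u → u ≡ + 2 ℤ.* x ℤ.+ u ℤ.- + 2 ℤ.* x
    u≡2x+u-2x = solve-∀
    2y-2x≡2[y-x] : ∀ x y → + 2 ℤ.* y ℤ.- + 2 ℤ.* x ≡ + 2 ℤ.* (y ℤ.- x)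
    2y-2x≡2[y-x] = solve-∀
    u≡2[y-x] : u ≡ + 2 ℤ.* (y ℤ.- x)
    u≡2[y-x] = trans (u≡2x+u-2x x u) (trans (cong (ℤ._- + 2 ℤ.* x) eq) (2y-2x≡2[y-x] x y))

  x-1<x : ∀ x → x ℤ.- 1ℤ ℤ.< x
  x-1<x x = ℤₚ.suc[i]≤j⇒i<j (ℤₚ.≤-reflexive (1+[x-1]≡x x))
    where
    1+[x-1]≡x : ∀ x → 1ℤ ℤ.+ (x ℤ.- 1ℤ) ≡ x
    1+[x-1]≡x = solve-∀

  x<x+1 : ∀ x → x ℤ.< x ℤ.+ 1ℤ
  x<x+1 x = ℤₚ.suc[i]≤j⇒i<j (ℤₚ.≤-reflexive (ℤₚ.+-comm 1ℤ x))

  x<y⇒2*x+1<2*y : ∀ {x y} → x ℤ.< y → + 2 ℤ.* x ℤ.+ 1ℤ ℤ.< + 2 ℤ.* y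
  x<y⇒2*x+1<2*y {x} {y} x<y = ℤₚ.suc[i]≤j⇒i<j (begin
    1ℤ ℤ.+ (+ 2 ℤ.* x ℤ.+ 1ℤ)  ≡⟨ 1+[2x+1]≡2[1+x] x ⟩
    + 2 ℤ.* (1ℤ ℤ.+ x)         ≤⟨ ℤₚ.*-monoˡ-≤-nonNeg (+ 2) (ℤₚ.i<j⇒suc[i]≤j x<y) ⟩
    + 2 ℤ.* y                  ∎)
    where
    open ℤₚ.≤-Reasoning
    1+[2x+1]≡2[1+x] : ∀ x → 1ℤ ℤ.+ (+ 2 ℤ.* x ℤ.+ 1ℤ) ≡ + 2 ℤ.* (1ℤ ℤ.+ x)
    1+[2x+1]≡2[1+x] = solve-∀

  x<z∧y<z⇒x+y<2*z-1 : ∀ {x y z} → x ℤ.< z → y ℤ.< z → x ℤ.+ y ℤ.< + 2 ℤ.* z ℤ.- 1ℤ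
  x<z∧y<z⇒x+y<2*z-1 {x} {y} {z} x<z y<z = ℤₚ.suc[i]≤j⇒i<j (begin
    1ℤ ℤ.+ (x ℤ.+ y)                  ≡⟨ 1+[x+y]≡[1+x]+[1+y]-1 x y ⟩
    (1ℤ ℤ.+ x) ℤ.+ (1ℤ ℤ.+ y) ℤ.- 1ℤ  ≤⟨ ℤₚ.+-monoˡ-≤ -1ℤ
                                           (ℤₚ.+-mono-≤ (ℤₚ.i<j⇒suc[i]≤j x<z) (ℤₚ.i<j⇒suc[i]≤j y<z)) ⟩
    z ℤ.+ z ℤ.- 1ℤ                    ≡⟨ cong (ℤ._- 1ℤ) (z+z≡2z z) ⟩
    + 2 ℤ.* z ℤ.- 1ℤ                  ∎)
    where
    open ℤₚ.≤-Reasoning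
    1+[x+y]≡[1+x]+[1+y]-1 : ∀ x y →
      1ℤ ℤ.+ (x ℤ.+ y) ≡ (1ℤ ℤ.+ x) ℤ.+ (1ℤ ℤ.+ y) ℤ.- 1ℤ
    1+[x+y]≡[1+x]+[1+y]-1 = solve-∀
    z+z≡2z : ∀ z → z ℤ.+ z ≡ + 2 ℤ.* z
    z+z≡2z = solve-∀

  s[2*p]≢2*y : ∀ p y → s (2 * p) ≢ + 2 ℤ.* y
  s[2*p]≢2*y p y with parity p
  ... | even q = λ eq → 2*x+u≢2*y (s q) y (∣-a∣≡1 q)
    (trans (sym (s[4*q]≡2*s[q]-a[q] q)) (trans (cong s (*-assoc 2 2 q)) eq))
  ... | odd q  = λ eq → 2*x+u≢2*y (s q) y (∣sign*a∣≡1 q)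
    (trans (sym (s[2+4*q]≡2*s[q]+sign[q]*a[q] q)) (trans (cong s (2+4*q≡2*[1+2*q] q)) eq))

  Quarter⇒s≤2*s[q]+1 : ∀ {q t} → Quarter q t → s t ℤ.≤ + 2 ℤ.* s q ℤ.+ 1ℤ
  Quarter⇒s≤2*s[q]+1 {q} 4q+0 = ℤₚ.≤-trans (ℤₚ.≤-reflexive (s[4*q]≡2*s[q]-a[q] q))
    (ℤₚ.+-monoʳ-≤ (+ 2 ℤ.* s q) (∣i∣≡1⇒i≤1 (∣-a∣≡1 q)))
  Quarter⇒s≤2*s[q]+1 {q} 4q+1 = ℤₚ.≤-trans (ℤₚ.≤-reflexive (s[1+4*q]≡2*s[q] q)) (ℤₚ.i≤i+j _ 1ℤ)
  Quarter⇒s≤2*s[q]+1 {q} 4q+2 = ℤₚ.≤-trans (ℤₚ.≤-reflexive (s[2+4*q]≡2*s[q]+sign[q]*a[q] q))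
    (ℤₚ.+-monoʳ-≤ (+ 2 ℤ.* s q) (∣i∣≡1⇒i≤1 (∣sign*a∣≡1 q)))
  Quarter⇒s≤2*s[q]+1 {q} 4q+3 = ℤₚ.≤-trans (ℤₚ.≤-reflexive (s[3+4*q]≡2*s[q] q)) (ℤₚ.i≤i+j _ 1ℤ)

  Quarter⇒s<2K-1 : ∀ {q t K} W → K ≡ 1ℤ ℤ.+ + 2 ℤ.* W → Quarter q t →
                   s q ℤ.< K → s q ℤ.- a q ℤ.< K → s t ℤ.< + 2 ℤ.* K ℤ.- 1ℤ
  Quarter⇒s<2K-1 {K = K} W K-odd = bound
    where
    split : ∀ t {x y} → s t ≡ x ℤ.+ y → x ℤ.< K → y ℤ.< K → s t ℤ.< + 2 ℤ.* K ℤ.- 1ℤ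
    split _ eq x<K y<K = ℤₚ.≤-<-trans (ℤₚ.≤-reflexive eq) (x<z∧y<z⇒x+y<2*z-1 x<K y<K)

    2x-y≡x+[x-y] : ∀ x y → + 2 ℤ.* x ℤ.- y ≡ x ℤ.+ (x ℤ.- y)
    2x-y≡x+[x-y] = solve-∀
    2x≡x+x : ∀ x → + 2 ℤ.* x ≡ x ℤ.+ x
    2x≡x+x = solve-∀
    2x+[-1]y≡x+[x-y] : ∀ x y → + 2 ℤ.* x ℤ.+ -1ℤ ℤ.* y ≡ x ℤ.+ (x ℤ.- y)
    2x+[-1]y≡x+[x-y] = solve-∀
    2x+1y≡[x+y]+x : ∀ x y → + 2 ℤ.* x ℤ.+ 1ℤ ℤ.* y ≡ (x ℤ.+ y) ℤ.+ x
    2x+1y≡[x+y]+x = solve-∀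

    s[2+4*q]≡2*s[q]+σ*a[q] : ∀ q {σ} → sign q ≡ σ →
                             s (2 + 4 * q) ≡ + 2 ℤ.* s q ℤ.+ σ ℤ.* a q
    s[2+4*q]≡2*s[q]+σ*a[q] q refl = s[2+4*q]≡2*s[q]+sign[q]*a[q] q

    bound : ∀ {q t} → Quarter q t → s q ℤ.< K → s q ℤ.- a q ℤ.< K →
            s t ℤ.< + 2 ℤ.* K ℤ.- 1ℤ
    bound {q} 4q+0 sq<K prev<K =
      split (4 * q) (trans (s[4*q]≡2*s[q]-a[q] q) (2x-y≡x+[x-y] (s q) (a q))) sq<K prev<K
    bound {q} 4q+1 sq<K _ = split (1 + 4 * q) (trans (s[1+4*q]≡2*s[q] q) (2x≡x+x (s q))) sq<K sq<K
    bound {q} 4q+3 sq<K _ = split (3 + 4 * q) (trans (s[3+4*q]≡2*s[q] q) (2x≡x+x (s q))) sq<K sq<K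
    bound {q} 4q+2 sq<K prev<K with parity q
    ... | odd p = split (2 + 4 * q)
      (trans (s[2+4*q]≡2*s[q]+σ*a[q] q (sign[1+2*n]≡-1 p)) (2x+[-1]y≡x+[x-y] (s q) (a q)))
      sq<K prev<K
    ... | even p = split (2 + 4 * q)
      (trans (s[2+4*q]≡2*s[q]+σ*a[q] q (sign[2*n]≡1 p)) (2x+1y≡[x+y]+x (s q) (a q)))
      sq+aq<K sq<K
      where
      -- s q is odd and K - 1 is even, so s q + 1 < K.
      1+sq<K : 1ℤ ℤ.+ s q ℤ.< K
      1+sq<K = ℤₚ.≤∧≢⇒< (ℤₚ.i<j⇒suc[i]≤j sq<K)
        (λ 1+sq≡K → s[2*p]≢2*y p W (∙-cancelˡ 1ℤ (s q) (+ 2 ℤ.* W) (trans 1+sq≡K K-odd)))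
      sq+aq<K : s q ℤ.+ a q ℤ.< K
      sq+aq<K = ℤₚ.≤-<-trans (ℤₚ.≤-trans (ℤₚ.+-monoʳ-≤ (s q) (∣i∣≡1⇒i≤1 (∣a∣≡1 q)))
                                (ℤₚ.≤-reflexive (ℤₚ.+-comm (s q) 1ℤ))) 1+sq<K

  FirstPassage : ℕ → ℤ → Set
  FirstPassage n K = s n ≡ K × (∀ j → j < n → s j ℤ.< K)

  passage⇒a≡1 : ∀ {n K} → FirstPassage n K → a n ≡ 1ℤ
  passage⇒a≡1 {zero} _ = refl
  passage⇒a≡1 {suc p} (s≡K , below) with ∣i∣≡1⇒i≡±1 (∣a∣≡1 (suc p))
  ... | inj₁ a≡1  = a≡1
  ... | inj₂ a≡-1 = contradiction
    (subst (s p ℤ.<_) (trans (sym s≡K) (cong (ℤ._+_ (s p)) a≡-1)) (below p (n<1+n p)))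
    (ℤₚ.≤⇒≯ (ℤₚ.i-j≤i (s p) (+ 1)))

  -- s q - a q is the sum of the a i over i < q.
  passage⇒s-a<K : ∀ {n K q} → FirstPassage n K → q < n → s q ℤ.- a q ℤ.< K
  passage⇒s-a<K {q = zero} (_ , below) 0<n = ℤₚ.<-trans (+<+ (s≤s z≤n)) (below 0 0<n)
  passage⇒s-a<K {q = suc p} (_ , below) q<n =
    subst (ℤ._< _) (sym (x+y-y≡x (s p) (a (suc p)))) (below p (<-trans (n<1+n p) q<n))

  passage⇒s[4*n]≡2K-1 : ∀ {n K} → FirstPassage n K → s (4 * n) ≡ + 2 ℤ.* K ℤ.- 1ℤ
  passage⇒s[4*n]≡2K-1 {n} fp@(s≡K , _) =
    trans (s[4*q]≡2*s[q]-a[q] n) (cong₂ (λ x y → + 2 ℤ.* x ℤ.- y) s≡K (passage⇒a≡1 fp))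

  passage⇒s[1+4*n]≡2K : ∀ {n K} → FirstPassage n K → s (1 + 4 * n) ≡ + 2 ℤ.* K
  passage⇒s[1+4*n]≡2K {n} (s≡K , _) = trans (s[1+4*q]≡2*s[q] n) (cong (+ 2 ℤ.*_) s≡K)

  passage⇒s[t<4n]<2K : ∀ {n K t} → FirstPassage n K → t < 4 * n → s t ℤ.< + 2 ℤ.* K
  passage⇒s[t<4n]<2K {t = t} (_ , below) t<4n with quarter t
  ... | q , v =
    ℤₚ.≤-<-trans (Quarter⇒s≤2*s[q]+1 v) (x<y⇒2*x+1<2*y (below q (Quarter⇒q<n v t<4n)))

  passage⇒s[t<4n]<2K-1 : ∀ {n K t} W → FirstPassage n K → K ≡ 1ℤ ℤ.+ + 2 ℤ.* W → t < 4 * n →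
                         s t ℤ.< + 2 ℤ.* K ℤ.- 1ℤ
  passage⇒s[t<4n]<2K-1 {n} {_} {t} W fp@(_ , below) K-odd t<4n with quarter t
  ... | q , v = Quarter⇒s<2K-1 W K-odd v (below q q<n) (passage⇒s-a<K fp q<n)
    where
    q<n : q < n
    q<n = Quarter⇒q<n v t<4n

  passage-double : ∀ {n K} → FirstPassage n K → FirstPassage (1 + 4 * n) (+ 2 ℤ.* K)
  passage-double {n} {K} fp = passage⇒s[1+4*n]≡2K fp , below
    where
    below : ∀ t → t < 1 + 4 * n → s t ℤ.< + 2 ℤ.* K
    below t (s≤s t≤4n) with m≤n⇒m<n∨m≡n t≤4n
    ... | inj₁ t<4n = passage⇒s[t<4n]<2K fp t<4n
    ... | inj₂ refl =
      ℤₚ.≤-<-trans (ℤₚ.≤-reflexive (passage⇒s[4*n]≡2K-1 fp)) (x-1<x (+ 2 ℤ.* K))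

  passage-double-1 : ∀ {n K} W → FirstPassage n K → K ≡ 1ℤ ℤ.+ + 2 ℤ.* W →
                     FirstPassage (4 * n) (+ 2 ℤ.* K ℤ.- 1ℤ)
  passage-double-1 W fp K-odd = passage⇒s[4*n]≡2K-1 fp , λ t → passage⇒s[t<4n]<2K-1 W fp K-odd

  passage-double+1 : ∀ {n K} → FirstPassage n K → sign n ≡ 1ℤ →
                     FirstPassage (2 + 4 * n) (+ 2 ℤ.* K ℤ.+ 1ℤ)
  passage-double+1 {n} {K} fp@(s≡K , _) sign≡1 = s≡2K+1 , below
    where
    s≡2K+1 : s (2 + 4 * n) ≡ + 2 ℤ.* K ℤ.+ 1ℤ
    s≡2K+1 = trans (s[2+4*q]≡2*s[q]+sign[q]*a[q] n)
      (cong₂ (λ x y → + 2 ℤ.* x ℤ.+ y) s≡K (cong₂ ℤ._*_ sign≡1 (passage⇒a≡1 fp)))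

    2K<2K+1 : + 2 ℤ.* K ℤ.< + 2 ℤ.* K ℤ.+ 1ℤ
    2K<2K+1 = x<x+1 (+ 2 ℤ.* K)

    below : ∀ t → t < 2 + 4 * n → s t ℤ.< + 2 ℤ.* K ℤ.+ 1ℤ
    below t (s≤s t≤1+4n) with m≤n⇒m<n∨m≡n t≤1+4n
    ... | inj₂ refl = ℤₚ.≤-<-trans (ℤₚ.≤-reflexive (passage⇒s[1+4*n]≡2K fp)) 2K<2K+1
    ... | inj₁ (s≤s t≤4n) with m≤n⇒m<n∨m≡n t≤4n
    ...   | inj₁ t<4n = ℤₚ.<-trans (passage⇒s[t<4n]<2K fp t<4n) 2K<2K+1
    ...   | inj₂ refl = ℤₚ.≤-<-trans (ℤₚ.≤-reflexive (passage⇒s[4*n]≡2K-1 fp))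
                          (ℤₚ.<-trans (x-1<x (+ 2 ℤ.* K)) 2K<2K+1)

  passage[1+2*j] : ∀ j → FirstPassage (2 * m j) (+ (1 + 2 * j))
  passage[1+2*j] = binary-induction P (refl , λ _ ()) step-even step-odd
    where
    P : ℕ → Set
    P j = FirstPassage (2 * m j) (+ (1 + 2 * j))

    +[1+2*j]≡1+2*+j : ∀ j → + (1 + 2 * j) ≡ 1ℤ ℤ.+ + 2 ℤ.* + j
    +[1+2*j]≡1+2*+j j = trans (ℤₚ.pos-+ 1 (2 * j)) (cong (ℤ._+_ 1ℤ) (ℤₚ.pos-* 2 j))

    4*[2*x]≡2*[4*x] : ∀ x → 4 * (2 * x) ≡ 2 * (4 * x)
    4*[2*x]≡2*[4*x] = ℕ-Solver.solve-∀

    2+4*[2*x]≡2*[1+4*x] : ∀ x → 2 + 4 * (2 * x) ≡ 2 * (1 + 4 * x)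
    2+4*[2*x]≡2*[1+4*x] = ℕ-Solver.solve-∀

    step-even : ∀ j → 0 < j → P j → P (2 * j)
    step-even j _ fp =
      subst₂ FirstPassage index level (passage-double-1 (+ j) fp (+[1+2*j]≡1+2*+j j))
      where
      index : 4 * (2 * m j) ≡ 2 * m (2 * j)
      index = trans (4*[2*x]≡2*[4*x] (m j)) (cong (2 *_) (sym (m[2*n]≡4*m[n] j)))
      level : + 2 ℤ.* + (1 + 2 * j) ℤ.- 1ℤ ≡ + (1 + 2 * (2 * j))
      level = cong (ℤ._- 1ℤ) (trans (sym (ℤₚ.pos-* 2 (1 + 2 * j))) (cong +_ (*-suc 2 (2 * j))))

    step-odd : ∀ j → P j → P (1 + 2 * j)
    step-odd j fp = subst₂ FirstPassage index level (passage-double+1 fp (sign[2*n]≡1 (m j)))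
      where
      index : 2 + 4 * (2 * m j) ≡ 2 * m (1 + 2 * j)
      index = trans (2+4*[2*x]≡2*[1+4*x] (m j)) (cong (2 *_) (sym (m[1+2*n]≡1+4*m[n] j)))
      level : + 2 ℤ.* + (1 + 2 * j) ℤ.+ 1ℤ ≡ + (1 + 2 * (1 + 2 * j))
      level = trans (ℤₚ.+-comm (+ 2 ℤ.* + (1 + 2 * j)) 1ℤ)
        (cong (ℤ._+_ 1ℤ) (sym (ℤₚ.pos-* 2 (1 + 2 * j))))

  passage-odd : ∀ {k} → k % 2 ≡ 1 → ∃ λ n → FirstPassage n (+ k) × 6 * n + 3 ≡ 3 * m k
  passage-odd {k} k%2≡1 =
    2 * m j ,
    subst (λ i → FirstPassage (2 * m j) (+ i)) 1+2*j≡k (passage[1+2*j] j) ,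
    trans (6*[2*x]+3≡3*[1+4*x] (m j))
      (cong (3 *_) (trans (sym (m[1+2*n]≡1+4*m[n] j)) (cong m 1+2*j≡k)))
    where
    j : ℕ
    j = k / 2
    1+2*j≡k : 1 + 2 * j ≡ k
    1+2*j≡k = sym (trans (ℕ.m≡m%n+[m/n]*n k 2) (cong₂ _+_ k%2≡1 (*-comm j 2)))
    6*[2*x]+3≡3*[1+4*x] : ∀ x → 6 * (2 * x) + 3 ≡ 3 * (1 + 4 * x)
    6*[2*x]+3≡3*[1+4*x] = ℕ-Solver.solve-∀

  passage-*2^ : ∀ {n k} → FirstPassage n (+ k) → 6 * n + 3 ≡ 3 * m k → ∀ ℓ →
                ∃ λ n′ → FirstPassage n′ (+ (k * 2 ^ ℓ)) × 6 * n′ + 4 ^ ℓ + 2 ≡ 3 * m (k * 2 ^ ℓ)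
  passage-*2^ {n} {k} fp formula zero =
    n ,
    subst (λ i → FirstPassage n (+ i)) (sym (*-identityʳ k)) fp ,
    trans (+-assoc (6 * n) 1 2) (trans formula (cong (λ i → 3 * m i) (sym (*-identityʳ k))))
  passage-*2^ {k = k} fp formula (suc ℓ) with passage-*2^ fp formula ℓ
  ... | n , fp′ , formula′ =
    1 + 4 * n , subst (FirstPassage (1 + 4 * n)) level (passage-double fp′) , formula″
    where
    open ≡-Reasoning
    2*[k*x]≡k*[2*x] : ∀ k x → 2 * (k * x) ≡ k * (2 * x)
    2*[k*x]≡k*[2*x] = ℕ-Solver.solve-∀
    6*[1+4*x]+4*y+2≡4*[6*x+y+2] : ∀ x y → 6 * (1 + 4 * x) + 4 * y + 2 ≡ 4 * (6 * x + y + 2)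
    6*[1+4*x]+4*y+2≡4*[6*x+y+2] = ℕ-Solver.solve-∀
    4*[3*x]≡3*[4*x] : ∀ x → 4 * (3 * x) ≡ 3 * (4 * x)
    4*[3*x]≡3*[4*x] = ℕ-Solver.solve-∀

    level : + 2 ℤ.* + (k * 2 ^ ℓ) ≡ + (k * 2 ^ suc ℓ)
    level = trans (sym (ℤₚ.pos-* 2 (k * 2 ^ ℓ))) (cong +_ (2*[k*x]≡k*[2*x] k (2 ^ ℓ)))

    formula″ : 6 * (1 + 4 * n) + 4 ^ suc ℓ + 2 ≡ 3 * m (k * 2 ^ suc ℓ)
    formula″ = begin
      6 * (1 + 4 * n) + 4 * 4 ^ ℓ + 2  ≡⟨ 6*[1+4*x]+4*y+2≡4*[6*x+y+2] n (4 ^ ℓ) ⟩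
      4 * (6 * n + 4 ^ ℓ + 2)          ≡⟨ cong (4 *_) formula′ ⟩
      4 * (3 * m (k * 2 ^ ℓ))          ≡⟨ 4*[3*x]≡3*[4*x] (m (k * 2 ^ ℓ)) ⟩
      3 * (4 * m (k * 2 ^ ℓ))          ≡⟨ cong (3 *_) (m[2*n]≡4*m[n] (k * 2 ^ ℓ)) ⟨
      3 * m (2 * (k * 2 ^ ℓ))          ≡⟨ cong (λ i → 3 * m i) (2*[k*x]≡k*[2*x] k (2 ^ ℓ)) ⟩
      3 * m (k * 2 ^ suc ℓ)            ∎

open import Data.Nat using (ℕ; _<_; _≥_; _^_; _%_)
import Data.Nat as ℕ
open import Data.Integer using (+_)
open import Data.Rational using (ℚ; _/_; _-_; _+_; _*_)
open import Data.Product using (∃; _×_; _,_)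
open import Relation.Binary.PropositionalEquality using (_≡_; _≢_; refl; sym; trans; cong)

import Data.Integer as ℤ
import Data.Integer.Properties as ℤₚ
open import Data.Integer.Tactic.RingSolver using (solve-∀)
open import Data.Rational using (toℚᵘ) renaming (-_ to -ℚ_)
import Data.Rational.Properties as ℚₚ
open import Data.Rational.Unnormalised using (ℚᵘ; mkℚᵘ; *≡*; _≃_)
  renaming (_+_ to _+ᵘ_; _-_ to _-ᵘ_; _*_ to _*ᵘ_; -_ to -ᵘ_)
import Data.Rational.Unnormalised.Properties as ℚᵘₚ

open RudinShapiro using (passage-odd; passage-*2^)

toℚᵘ[+p/1+q]≃mkℚᵘ : ∀ p q → toℚᵘ (+ p / ℕ.suc q) ≃ mkℚᵘ (+ p) q
toℚᵘ[+p/1+q]≃mkℚᵘ p q = ℚₚ.toℚᵘ-fromℚᵘ (mkℚᵘ (+ p) q)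

ℚ-formula : ∀ n M X → 6 ℕ.* n ℕ.+ X ℕ.+ 2 ≡ 3 ℕ.* M →
  (+ n / 1) ≡ (+ M / 2) - (((+ (2 ℕ.* X) / 4) + (+ 1 / 1)) * (+ 1 / 3))
ℚ-formula n M X h = ℚₚ.toℚᵘ-injective (begin
  toℚᵘ (+ n / 1)        ≈⟨ toℚᵘ[+p/1+q]≃mkℚᵘ n 0 ⟩
  mkℚᵘ (+ n) 0          ≈⟨ *≡* cross-multiplied ⟩
  rhsᵘ                  ≈⟨ toℚᵘ-rhs ⟨
  toℚᵘ ((+ M / 2) - Q)  ∎)
  where
  open ℚᵘₚ.≃-Reasoning
  S Q : ℚ
  S = (+ (2 ℕ.* X) / 4) + (+ 1 / 1)
  Q = S * (+ 1 / 3)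
  R rhsᵘ : ℚᵘ
  R = toℚᵘ (+ M / 2)
  rhsᵘ = mkℚᵘ (+ M) 1 -ᵘ (mkℚᵘ (+ (2 ℕ.* X)) 3 +ᵘ mkℚᵘ (+ 1) 0) *ᵘ mkℚᵘ (+ 1) 2

  toℚᵘ-rhs : toℚᵘ ((+ M / 2) - Q) ≃ rhsᵘ
  toℚᵘ-rhs = begin
    toℚᵘ ((+ M / 2) - Q)                ≈⟨ ℚₚ.toℚᵘ-homo-+ (+ M / 2) (-ℚ Q) ⟩
    R +ᵘ toℚᵘ (-ℚ Q)                    ≈⟨ ℚᵘₚ.+-congʳ R (ℚₚ.toℚᵘ-homo‿- Q) ⟩
    R +ᵘ -ᵘ toℚᵘ Q
      ≈⟨ ℚᵘₚ.+-congʳ R (ℚᵘₚ.-‿cong (ℚₚ.toℚᵘ-homo-* S (+ 1 / 3))) ⟩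
    R +ᵘ -ᵘ (toℚᵘ S *ᵘ toℚᵘ (+ 1 / 3))
      ≈⟨ ℚᵘₚ.+-congʳ R (ℚᵘₚ.-‿cong (ℚᵘₚ.*-cong (ℚₚ.toℚᵘ-homo-+ (+ (2 ℕ.* X) / 4) (+ 1 / 1))
                                                  (toℚᵘ[+p/1+q]≃mkℚᵘ 1 2))) ⟩
    R +ᵘ -ᵘ ((toℚᵘ (+ (2 ℕ.* X) / 4) +ᵘ toℚᵘ (+ 1 / 1)) *ᵘ mkℚᵘ (+ 1) 2)
      ≈⟨ ℚᵘₚ.+-cong (toℚᵘ[+p/1+q]≃mkℚᵘ M 1)
           (ℚᵘₚ.-‿cong (ℚᵘₚ.*-congʳ (ℚᵘₚ.+-cong (toℚᵘ[+p/1+q]≃mkℚᵘ (2 ℕ.* X) 3)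
                                                 (toℚᵘ[+p/1+q]≃mkℚᵘ 1 0)))) ⟩
    rhsᵘ                                ∎

  hℤ : + 6 ℤ.* + n ℤ.+ + X ℤ.+ + 2 ≡ + 3 ℤ.* + M
  hℤ = trans (cong (λ y → y ℤ.+ + X ℤ.+ + 2) (sym (ℤₚ.pos-* 6 n)))
         (trans (cong +_ h) (ℤₚ.pos-* 3 M))

  24n≡4[6n+X+2]-4X-8 : ∀ n X →
    n ℤ.* + 24 ≡ + 4 ℤ.* (+ 6 ℤ.* n ℤ.+ X ℤ.+ + 2) ℤ.- + 4 ℤ.* X ℤ.- + 8
  24n≡4[6n+X+2]-4X-8 = solve-∀
  4[3M]-4X-8≡num : ∀ M X → + 4 ℤ.* (+ 3 ℤ.* M) ℤ.- + 4 ℤ.* X ℤ.- + 8 ≡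
    (M ℤ.* + 12 ℤ.+ ℤ.- (((+ 2 ℤ.* X) ℤ.* + 1 ℤ.+ + 1 ℤ.* + 4) ℤ.* + 1) ℤ.* + 2) ℤ.* + 1
  4[3M]-4X-8≡num = solve-∀

  -- mkℚᵘ (+ n) 0 ≃ rhsᵘ with the numerator and denominator of rhsᵘ as Agda computes them.
  cross-multiplied : + n ℤ.* + 24 ≡
    (+ M ℤ.* + 12 ℤ.+ ℤ.- ((+ (2 ℕ.* X) ℤ.* + 1 ℤ.+ + 1 ℤ.* + 4) ℤ.* + 1) ℤ.* + 2) ℤ.* + 1
  cross-multiplied =
    trans (24n≡4[6n+X+2]-4X-8 (+ n) (+ X))
      (trans (cong (λ y → + 4 ℤ.* y ℤ.- + 4 ℤ.* + X ℤ.- + 8) hℤ)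
        (trans (4[3M]-4X-8≡num (+ M) (+ X))
          (cong (λ y → (+ M ℤ.* + 12 ℤ.+ ℤ.- ((y ℤ.* + 1 ℤ.+ + 1 ℤ.* + 4) ℤ.* + 1) ℤ.* + 2) ℤ.* + 1)
            (sym (ℤₚ.pos-* 2 X)))))

theorem29 : (k k′ ℓ : ℕ) → k ≥ 1 → k′ % 2 ≡ 1 → k ≡ k′ ℕ.* 2 ^ ℓ →
    ∃ λ n → (s n ≡ + k) × (∀ j → j < n → s j ≢ + k) ×
    ((+ n / 1) ≡ (+ m k / 2) - (((+ (2 ℕ.* 4 ^ ℓ) / 4) + (+ 1 / 1)) * (+ 1 / 3)))
theorem29 _ k′ ℓ _ k′-odd refl with passage-odd {k′} k′-odd
... | n₀ , passage₀ , formula₀ with passage-*2^ passage₀ formula₀ ℓ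
...   | n , (s≡k , below) , formula =
  n , s≡k , (λ j j<n → ℤₚ.<⇒≢ (below j j<n)) , ℚ-formula n (m (k′ ℕ.* 2 ^ ℓ)) (4 ^ ℓ) formula
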